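{- For all integers $n,q\ge 2$, $$(n/q)^{q-1}\le f(q,n)\le (n-1)^{q-1}+1.$$
   Context: $D_N$ is the complete digraph on $N$ vertices (each pair of distinct vertices joined by two oppositely directed edges, no loops). A walk of length $n$ is a sequence of $n$ vertices $v_1,\dots,v_n$ (repetitions allowed) with each $\overrightarrow{v_iv_{i+1}}$ an edge; it is monochromatic if all these edges have the same color. $f(q,n)$ is the smallest $N$ such that every coloring of the edges of $D_N$ with $q$ colors contains a monochromatic walk of length $n$. -}

module Defs where

open import Data.Nat using (ℕ; suc; _<_; _≤_; _+_; _*_; _^_; _∸_)
open import Data.Fin using (Fin; toℕ)
open import Data.Product using (Σ; ∃; _×_)
open import Relation.Binary.PropositionalEquality using (_≡_; _≢_)
open import Relation.Nullary using (¬_)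

-- A q-colouring of the edges of the complete digraph D_N on vertex set Fin N:
-- the edge from u to v (u ≢ v) gets colour c u v.  Values c u u are
-- irrelevant (there are no loops).
Colouring : ℕ → ℕ → Set
Colouring q N = Fin N → Fin N → Fin q

-- A walk of length n in D_N: a sequence of n vertices v_1..v_n such that
-- consecutive vertices are distinct (i.e. each v_i v_{i+1} is an edge).
IsWalk : ∀ {N n} → (Fin n → Fin N) → Set
IsWalk {n = n} w = ∀ (i j : Fin n) → toℕ j ≡ suc (toℕ i) → w i ≢ w j

MonoOf : ∀ {q N n} → Colouring q N → Fin q → (Fin n → Fin N) → Set
MonoOf {n = n} c k w = ∀ (i j : Fin n) → toℕ j ≡ suc (toℕ i) → c (w i) (w j) ≡ k

HasMonoWalk : ℕ → ∀ {q N} → Colouring q N → Set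
HasMonoWalk n {q} {N} c =
  Σ (Fin n → Fin N) λ w → IsWalk w × Σ (Fin q) λ k → MonoOf c k w

Forces : ℕ → ℕ → ℕ → Set
Forces q n N = ∀ (c : Colouring q N) → HasMonoWalk n c

IsF : ℕ → ℕ → ℕ → Set
IsF q n N = Forces q n N × (∀ M → M < N → ¬ Forces q n M)

-- Existence: being forced is decidable (walks and colourings live in finite
-- function spaces, enumerated via the coding Fin (b ^ a) of Fin a → Fin b),
-- so f(q,n) is the least witness below the upper bound.
--
-- Upper bound (q = p+1, n = m+1, N = m^p + 1): without monochromatic walks
-- with m edges, the height of v in colour k (the most edges of a k-walk from
-- v) lies in [0,m) and drops along every k-edge.  By pigeonhole two vertices
-- share their heights in colours 1..p; the edges between them must then both
-- have colour 0, so height 0 drops both ways.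
--
-- Lower bound: potentials separating all ordered pairs give a colouring by
-- "a potential rising along the edge" with only short monochromatic walks.
-- With t = ⌊(n-2)/p⌋ the base-(t+1) digits of v < (t+1)^p and p·t minus their
-- sum are such potentials, and q^p·M < n^p forces M < (t+1)^p as n ≤ q(t+1).
module Submission where

open import Defs
open import Data.Nat
  using (ℕ; zero; suc; _≤_; _<_; _<?_; _+_; _*_; _^_; _∸_; z≤n; s≤s; s≤s⁻¹; z<s; NonZero; +-0-rawMonoid)
open import Data.Nat.Properties
open import Data.Nat.DivMod using (_/_; _%_; m≡m%n+[m/n]*n; m%n<n)
open import Data.Nat.Induction using (<-rec)
open import Data.Fin using (Fin; toℕ; fromℕ<; inject₁; inject≤; finToFun; funToFin; combine)
  renaming (zero to fzero; suc to fsuc)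
open import Data.Fin.Properties
  using (any?; all?; pigeonhole; toℕ-fromℕ<; toℕ-inject₁; toℕ<n; toℕ-injective;
         inject≤-injective; finToFun-funToFin; funToFin-finToFin)
  renaming (_≟_ to _≟ᶠ_; <⇒≢ to <⇒≢ᶠ)
open import Data.Product using (Σ; _×_; _,_; proj₁; proj₂; ∃)
open import Data.Sum using (inj₁; inj₂)
open import Data.Empty using (⊥; ⊥-elim)
open import Function using (_∘_)
open import Relation.Nullary using (¬_; Dec; yes; no)
open import Relation.Nullary.Decidable using (_×-dec_; _→-dec_; ¬?)
open import Relation.Unary using (Decidable)
open import Relation.Binary.PropositionalEquality
  using (_≡_; _≢_; _≗_; refl; sym; trans; subst; cong; cong₂; module ≡-Reasoning)
open import Algebra.Definitions.RawMonoid +-0-rawMonoid using (sum)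
open import Algebra.Properties.CommutativeSemigroup *-commutativeSemigroup using (interchange)

-- A predicate on functions is invariant if it respects pointwise equality
-- (without function extensionality this has to be assumed).
Invariant : ∀ {a b} → ((Fin a → Fin b) → Set) → Set
Invariant P = ∀ {f g} → f ≗ g → P f → P g

funToFin-cong : ∀ {a b} {f g : Fin a → Fin b} → f ≗ g → funToFin f ≡ funToFin g
funToFin-cong {zero}  f≗g = refl
funToFin-cong {suc a} f≗g = cong₂ combine (f≗g fzero) (funToFin-cong (f≗g ∘ fsuc))

-- Every f : Fin a → Fin b is pointwise equal to the decoding of its code, so
-- it suffices to search through the codes Fin (b ^ a).
any-fun? : ∀ {a b} (P : (Fin a → Fin b) → Set) → Invariant P → Decidable P → Dec (∃ P)
any-fun? P invariant P? with any? (P? ∘ finToFun)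
... | yes (i , p) = yes (finToFun i , p)
... | no none      = no λ (f , p) → none (funToFin f , invariant (sym ∘ finToFun-funToFin f) p)

all-fun? : ∀ {a b} (P : (Fin a → Fin b) → Set) → Invariant P → Decidable P → Dec (∀ f → P f)
all-fun? P invariant P? with all? (P? ∘ finToFun)
... | yes all = yes λ f → invariant (finToFun-funToFin f) (all (funToFin f))
... | no ¬all = no λ all → ¬all (all ∘ finToFun)

hasMonoWalk-resp : ∀ n {q N} {c c′ : Colouring q N} →
  (∀ u v → c u v ≡ c′ u v) → HasMonoWalk n c → HasMonoWalk n c′
hasMonoWalk-resp n c≈c′ (w , walk , k , mono) =
  w , walk , k , λ i j j≡1+i → trans (sym (c≈c′ (w i) (w j))) (mono i j j≡1+i)

hasMonoWalk? : ∀ n {q N} (c : Colouring q N) → Dec (HasMonoWalk n c)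
hasMonoWalk? n {q} {N} c = any-fun? MonoWalk invariant monoWalk?
  where
    MonoWalk : (Fin n → Fin N) → Set
    MonoWalk w = IsWalk w × Σ (Fin q) λ k → MonoOf c k w

    invariant : Invariant MonoWalk
    invariant w≗w′ (walk , k , mono) =
        (λ i j j≡1+i eq → walk i j j≡1+i (trans (w≗w′ i) (trans eq (sym (w≗w′ j)))))
      , k , λ i j j≡1+i → trans (cong₂ c (sym (w≗w′ i)) (sym (w≗w′ j))) (mono i j j≡1+i)

    monoWalk? : Decidable MonoWalk
    monoWalk? w =
      all? (λ i → all? λ j → (toℕ j ≟ suc (toℕ i)) →-dec ¬? (w i ≟ᶠ w j))
      ×-dec any? (λ k → all? λ i → all? λ j → (toℕ j ≟ suc (toℕ i)) →-dec (c (w i) (w j) ≟ᶠ k))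

decodeColouring : ∀ {q N} → (Fin N → Fin (q ^ N)) → Colouring q N
decodeColouring d u = finToFun (d u)

forces? : ∀ q n N → Dec (Forces q n N)
forces? q n N with all-fun? (HasMonoWalk n ∘ decodeColouring) invariant (hasMonoWalk? n ∘ decodeColouring)
  where
    invariant : Invariant (HasMonoWalk n ∘ decodeColouring)
    invariant d≗d′ = hasMonoWalk-resp n λ u v → cong (λ x → finToFun x v) (d≗d′ u)
... | yes all = yes λ c → hasMonoWalk-resp n (finToFun-funToFin ∘ c) (all (funToFin ∘ c))
... | no ¬all = no λ forces → ¬all (forces ∘ decodeColouring)

record Least (P : ℕ → Set) (U : ℕ) : Set where
  field
    value   : ℕ
    holds   : P value
    value≤U : value ≤ U
    minimal : ∀ M → M < value → ¬ P M

least : ∀ {P : ℕ → Set} → Decidable P → ∀ U → P U → Least P U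
least {P} P? = <-rec (λ U → P U → Least P U) search
  where
    search : ∀ U → (∀ {M} → M < U → P M → Least P M) → P U → Least P U
    search U smaller pU with anyUpTo? P? U
    ... | no none = record
      { value = U ; holds = pU ; value≤U = ≤-refl
      ; minimal = λ M M<U pM → none (M , M<U , pM) }
    ... | yes (M , M<U , pM) = record
      { value = value ; holds = holds ; value≤U = ≤-trans value≤U (<⇒≤ M<U)
      ; minimal = minimal }
      where open Least (smaller M<U pM)

record Greatest (P : ℕ → Set) (b : ℕ) : Set where
  field
    value   : ℕ
    value≤b : value ≤ b
    holds   : P value
    maximal : ∀ {i} → i ≤ b → P i → i ≤ value

greatest : ∀ {P : ℕ → Set} → Decidable P → P 0 → ∀ b → Greatest P b
greatest         P? p0 zero    = record { value = 0 ; value≤b = z≤n ; holds = p0 ; maximal = λ i≤0 _ → i≤0 }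
greatest {P} P? p0 (suc b) with P? (suc b)
... | yes pb = record { value = suc b ; value≤b = ≤-refl ; holds = pb ; maximal = λ i≤b _ → i≤b }
... | no ¬pb = record { value = value ; value≤b = m≤n⇒m≤1+n value≤b ; holds = holds ; maximal = maximal′ }
  where
    open Greatest (greatest P? p0 b)
    maximal′ : ∀ {i} → i ≤ suc b → P i → i ≤ value
    maximal′ i≤1+b pi with m≤n⇒m<n∨m≡n i≤1+b
    ... | inj₁ i<1+b = maximal (s≤s⁻¹ i<1+b) pi
    ... | inj₂ refl  = ⊥-elim (¬pb pi)

-- Walk c k j u: a walk of colour k with j edges starting at u.
data Walk {q N} (c : Colouring q N) (k : Fin q) : ℕ → Fin N → Set where
  stop : ∀ u → Walk c k 0 u
  step : ∀ {j u v} → u ≢ v → c u v ≡ k → Walk c k j v → Walk c k (suc j) u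

module _ {q N} {c : Colouring q N} {k : Fin q} where

  walk? : ∀ j u → Dec (Walk c k j u)
  walk? zero    u = yes (stop u)
  walk? (suc j) u with any? (λ v → ¬? (u ≟ᶠ v) ×-dec (c u v ≟ᶠ k) ×-dec walk? j v)
  ... | yes (v , u≢v , colour , rest) = yes (step u≢v colour rest)
  ... | no none = no λ { (step u≢v colour rest) → none (_ , u≢v , colour , rest) }

  vertices : ∀ {j u} → Walk c k j u → Fin (suc j) → Fin N
  vertices (stop u)                  _        = u
  vertices (step {u = u} _ _ rest)   fzero    = u
  vertices (step _ _ rest)           (fsuc i) = vertices rest i

  vertices-start : ∀ {j u} (w : Walk c k j u) → vertices w fzero ≡ u
  vertices-start (stop u)       = refl
  vertices-start (step _ _ _)   = refl

  vertices-edge : ∀ {j u} (w : Walk c k j u) (i i′ : Fin (suc j)) → toℕ i′ ≡ suc (toℕ i) →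
    vertices w i ≢ vertices w i′ × c (vertices w i) (vertices w i′) ≡ k
  vertices-edge (stop _) fzero fzero ()
  vertices-edge (stop _) fzero (fsuc ()) _
  vertices-edge (stop _) (fsuc ()) _ _
  vertices-edge (step _ _ _) fzero fzero ()
  vertices-edge (step {u = u} u≢v colour rest) fzero (fsuc fzero) refl
    rewrite vertices-start rest = u≢v , colour
  vertices-edge (step _ _ _) fzero (fsuc (fsuc _)) ()
  vertices-edge (step _ _ _) (fsuc _) fzero ()
  vertices-edge (step _ _ rest) (fsuc i) (fsuc i′) eq = vertices-edge rest i i′ (suc-injective eq)

  walk⇒hasMonoWalk : ∀ {j u} → Walk c k j u → HasMonoWalk (suc j) c
  walk⇒hasMonoWalk w =
    vertices w , (λ i i′ eq → proj₁ (vertices-edge w i i′ eq))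
    , k , (λ i i′ eq → proj₂ (vertices-edge w i i′ eq))

-- The upper bound f(p+1, m+1) ≤ m^p + 1.

module NoLongWalk {p m} (c : Colouring (suc p) (m ^ p + 1))
                  (noWalk : ∀ k v → ¬ Walk c k m v) where

  heightOf : ∀ k v → Greatest (λ j → Walk c k j v) m
  heightOf k v = greatest (λ j → walk? j v) (stop v) m

  height : Fin (suc p) → Fin (m ^ p + 1) → ℕ
  height k v = Greatest.value (heightOf k v)

  height<m : ∀ k v → height k v < m
  height<m k v with m≤n⇒m<n∨m≡n (Greatest.value≤b (heightOf k v))
  ... | inj₁ h<m  = h<m
  ... | inj₂ h≡m  = ⊥-elim (noWalk k v (subst (λ j → Walk c k j v) h≡m (Greatest.holds (heightOf k v))))

  -- Prepending an edge of colour k to a longest k-walk from v.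
  descends : ∀ {k u v} → u ≢ v → c u v ≡ k → height k v < height k u
  descends {k} {u} {v} u≢v colour =
    Greatest.maximal (heightOf k u) (height<m k v) (step u≢v colour (Greatest.holds (heightOf k v)))

  profile : Fin (m ^ p + 1) → Fin (m ^ p)
  profile v = funToFin λ k → fromℕ< (height<m (fsuc k) v)

  profile-heights : ∀ {u v} → profile u ≡ profile v → ∀ k → height (fsuc k) u ≡ height (fsuc k) v
  profile-heights {u} {v} eq k = begin
    height (fsuc k) u                                       ≡⟨ toℕ-fromℕ< (height<m (fsuc k) u) ⟨
    toℕ (fromℕ< (height<m (fsuc k) u))                      ≡⟨ cong toℕ (finToFun-funToFin _ k) ⟨
    toℕ (finToFun (profile u) k)                            ≡⟨ cong (λ x → toℕ (finToFun x k)) eq ⟩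
    toℕ (finToFun (profile v) k)                            ≡⟨ cong toℕ (finToFun-funToFin _ k) ⟩
    toℕ (fromℕ< (height<m (fsuc k) v))                      ≡⟨ toℕ-fromℕ< (height<m (fsuc k) v) ⟩
    height (fsuc k) v                                       ∎
    where open ≡-Reasoning

  clash : ∀ {u v} → u ≢ v → profile u ≡ profile v → ⊥
  clash {u} {v} u≢v same with c u v in uv | c v u in vu
  ... | fsuc k | _      = <-irrefl (sym (profile-heights same k)) (descends u≢v uv)
  ... | fzero  | fsuc k = <-irrefl (profile-heights same k) (descends (u≢v ∘ sym) vu)
  ... | fzero  | fzero  = <-asym (descends u≢v uv) (descends (u≢v ∘ sym) vu)

  absurd : ⊥
  absurd with pigeonhole (m<m+n (m ^ p) z<s) profile
  ... | u , v , u<v , same = clash (<⇒≢ᶠ u<v) same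

forces-upper-bound : ∀ p m → Forces (suc p) (suc m) (m ^ p + 1)
forces-upper-bound p m c with any? (λ k → any? (λ v → walk? {c = c} {k = k} m v))
... | yes (k , v , w) = walk⇒hasMonoWalk w
... | no none         = ⊥-elim (NoLongWalk.absurd c λ k v w → none (k , v , w))

-- Lower bounds from separating potentials.

record Separating (p b M : ℕ) : Set where
  field
    height    : Fin (suc p) → Fin M → ℕ
    bounded   : ∀ k v → height k v ≤ b
    separates : ∀ u v → u ≢ v → Σ (Fin (suc p)) λ k → height k u < height k v

increasing⇒index≤ : ∀ {n} (g : Fin n → ℕ) →
  (∀ i j → toℕ j ≡ suc (toℕ i) → g i < g j) → ∀ i → toℕ i ≤ g i
increasing⇒index≤ g increasing fzero    = z≤n
increasing⇒index≤ g increasing (fsuc i) = ≤-<-trans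
  (increasing⇒index≤ (g ∘ inject₁) (λ i j eq → increasing (inject₁ i) (inject₁ j)
    (trans (toℕ-inject₁ j) (trans eq (cong suc (sym (toℕ-inject₁ i)))))) i)
  (increasing (inject₁ i) (fsuc i) (cong suc (sym (toℕ-inject₁ i))))

-- Colour each edge by a potential rising along it: a monochromatic walk
-- climbs one of the potentials, so it has at most b+1 vertices.
module SeparatingColouring {p b M} (sep : Separating p b M) where
  open Separating sep

  colourBy : ∀ u v → Dec (u ≡ v) → Fin (suc p)
  colourBy u v (yes _)  = fzero
  colourBy u v (no u≢v) = proj₁ (separates u v u≢v)

  colour : Colouring (suc p) M
  colour u v = colourBy u v (u ≟ᶠ v)

  rises : ∀ u v → u ≢ v → height (colour u v) u < height (colour u v) v
  rises u v u≢v with u ≟ᶠ v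
  ... | yes u≡v = ⊥-elim (u≢v u≡v)
  ... | no u≢v′ = proj₂ (separates u v u≢v′)

  noLongWalk : ∀ {n} → suc b < n → ¬ HasMonoWalk n colour
  noLongWalk {n} b+1<n (w , walk , k , mono) = 1+n≰n (≤-trans top (bounded k (w last)))
    where
      climbs : ∀ i j → toℕ j ≡ suc (toℕ i) → height k (w i) < height k (w j)
      climbs i j eq with mono i j eq
      ... | refl = rises (w i) (w j) (walk i j eq)

      last : Fin n
      last = fromℕ< b+1<n

      top : suc b ≤ height k (w last)
      top = subst (_≤ height k (w last)) (toℕ-fromℕ< b+1<n) (increasing⇒index≤ (height k ∘ w) climbs last)

separating⇒¬forces : ∀ {p b M n} → Separating p b M → suc b < n → ¬ Forces (suc p) n M
separating⇒¬forces sep b+1<n forces = noLongWalk b+1<n (forces colour)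
  where open SeparatingColouring sep

sum≤ : ∀ {p t} (x : Fin p → ℕ) → (∀ k → x k ≤ t) → sum x ≤ p * t
sum≤ {zero}  x bound = z≤n
sum≤ {suc p} x bound = +-mono-≤ (bound fzero) (sum≤ (x ∘ fsuc) (bound ∘ fsuc))

sum-mono-≤ : ∀ {p} {x y : Fin p → ℕ} → (∀ k → x k ≤ y k) → sum x ≤ sum y
sum-mono-≤ {zero}  x≤y = z≤n
sum-mono-≤ {suc p} x≤y = +-mono-≤ (x≤y fzero) (sum-mono-≤ (x≤y ∘ fsuc))

sum-mono-< : ∀ {p} {x y : Fin p → ℕ} → (∀ k → x k ≤ y k) → ∀ k → x k < y k → sum x < sum y
sum-mono-< x≤y fzero    x<y = +-mono-<-≤ x<y (sum-mono-≤ (x≤y ∘ fsuc))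
sum-mono-< x≤y (fsuc k) x<y = +-mono-≤-< (x≤y fzero) (sum-mono-< (x≤y ∘ fsuc) k x<y)

module Digits {p t M} (M≤ : M ≤ suc t ^ p) where

  digitVector : Fin M → Fin p → Fin (suc t)
  digitVector v = finToFun {suc t} {p} (inject≤ v M≤)

  digits : Fin M → Fin p → ℕ
  digits v k = toℕ (digitVector v k)

  digit≤t : ∀ v k → digits v k ≤ t
  digit≤t v k = s≤s⁻¹ (toℕ<n (digitVector v k))

  digits-injective : ∀ {u v} → (∀ k → digits u k ≡ digits v k) → u ≡ v
  digits-injective {u} {v} same = inject≤-injective M≤ M≤ u v (begin
    inject≤ u M≤              ≡⟨ funToFin-finToFin {p} {suc t} (inject≤ u M≤) ⟨
    funToFin (digitVector u)  ≡⟨ funToFin-cong (toℕ-injective ∘ same) ⟩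
    funToFin (digitVector v)  ≡⟨ funToFin-finToFin {p} {suc t} (inject≤ v M≤) ⟩
    inject≤ v M≤              ∎)
    where open ≡-Reasoning

  height : Fin (suc p) → Fin M → ℕ
  height fzero    v = p * t ∸ sum (digits v)
  height (fsuc k) v = digits v k

  bounded : ∀ k v → height k v ≤ p * t
  bounded fzero    v = m∸n≤m (p * t) (sum (digits v))
  bounded (fsuc k) v = ≤-trans (digit≤t v k) (t≤p*t k)
    where
      t≤p*t : ∀ {p} → Fin p → t ≤ p * t
      t≤p*t {suc p} _ = m≤m+n t (p * t)

  -- Either some digit rises from u to v, or all digits weakly fall and, as
  -- u ≢ v, one falls strictly, so the digit sum falls.
  separates : ∀ u v → u ≢ v → Σ (Fin (suc p)) λ k → height k u < height k v
  separates u v u≢v with any? (λ k → digits u k <? digits v k)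
  ... | yes (k , rise) = fsuc k , rise
  ... | no noRise with any? (λ k → digits v k <? digits u k)
  ...   | yes (k , fall) = fzero , ∸-monoʳ-< (sum-mono-< falls k fall) (sum≤ (digits u) (digit≤t u))
    where
      falls : ∀ k → digits v k ≤ digits u k
      falls k = ≮⇒≥ λ rise → noRise (k , rise)
  ...   | no noFall = ⊥-elim (u≢v (digits-injective λ k →
            ≤-antisym (≮⇒≥ λ fall → noFall (k , fall)) (≮⇒≥ λ rise → noRise (k , rise))))

  separating : Separating p (p * t) M
  separating = record { height = height ; bounded = bounded ; separates = separates }

^-distribʳ-* : ∀ m n o → (m * n) ^ o ≡ m ^ o * n ^ o
^-distribʳ-* m n zero    = refl
^-distribʳ-* m n (suc o) = trans (cong (m * n *_) (^-distribʳ-* m n o)) (interchange m n (m ^ o) (n ^ o))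

-- For n = n′ + 2 and t = ⌊n′/p⌋ the potentials are bounded by p·t ≤ n - 2,
-- while (t+1)^p is large enough because n ≤ (p+1)(t+1).
module Parameter (n′ p : ℕ) .{{_ : NonZero p}} where

  t : ℕ
  t = n′ / p

  p*t≤n′ : p * t ≤ n′
  p*t≤n′ = begin
    p * t          ≡⟨ *-comm p t ⟩
    t * p          ≤⟨ m≤n+m (t * p) (n′ % p) ⟩
    n′ % p + t * p ≡⟨ m≡m%n+[m/n]*n n′ p ⟨
    n′             ∎
    where open ≤-Reasoning

  n≤q*[t+1] : suc (suc n′) ≤ suc p * suc t
  n≤q*[t+1] = begin
    suc (suc n′)          ≤⟨ s≤s n′<p*[t+1] ⟩
    suc (p * suc t)       ≤⟨ +-monoˡ-≤ (p * suc t) (s≤s z≤n) ⟩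
    suc t + p * suc t     ∎
    where
      open ≤-Reasoning
      n′<p*[t+1] : n′ < p * suc t
      n′<p*[t+1] = begin-strict
        n′             ≡⟨ m≡m%n+[m/n]*n n′ p ⟩
        n′ % p + t * p <⟨ +-monoˡ-< (t * p) (m%n<n n′ p) ⟩
        p + t * p      ≡⟨ cong (p +_) (*-comm t p) ⟩
        p + p * t      ≡⟨ *-suc p t ⟨
        p * suc t      ∎

¬forces-below : ∀ r n′ M → suc (suc r) ^ suc r * M < suc (suc n′) ^ suc r →
  ¬ Forces (suc (suc r)) (suc (suc n′)) M
¬forces-below r n′ M small =
  separating⇒¬forces (Digits.separating (<⇒≤ M<[t+1]^p)) (s≤s (s≤s p*t≤n′))
  where
    p q : ℕ
    p = suc r
    q = suc p
    open Parameter n′ p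
    M<[t+1]^p : M < suc t ^ p
    M<[t+1]^p = *-cancelˡ-< (q ^ p) M (suc t ^ p) (begin-strict
      q ^ p * M           <⟨ small ⟩
      suc (suc n′) ^ p    ≤⟨ ^-monoˡ-≤ p n≤q*[t+1] ⟩
      (q * suc t) ^ p     ≡⟨ ^-distribʳ-* q (suc t) p ⟩
      q ^ p * suc t ^ p   ∎)
      where open ≤-Reasoning

theorem8 : ∀ (n q : ℕ) → 2 ≤ n → 2 ≤ q →
    Σ ℕ λ N → IsF q n N × (n ^ (q ∸ 1) ≤ q ^ (q ∸ 1) * N) × (N ≤ (n ∸ 1) ^ (q ∸ 1) + 1)
theorem8 (suc (suc n′)) (suc (suc r)) _ _ =
  value , (holds , minimal) , ≮⇒≥ (λ small → ¬forces-below r n′ value small holds) , value≤U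
  where open Least (least (forces? _ _) _ (forces-upper-bound (suc r) (suc n′)))
theorem8 (suc (suc _)) (suc zero) _ (s≤s ())
theorem8 (suc zero)    _          (s≤s ()) _
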